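{- Let $M$ be a finite monoid acting on the left of a finite set $\Omega$, let $P$ be an adapted probability on $M$, and let $\mathcal M=(\Omega,T)$ be the random walk of $M$ on $\Omega$ driven by $P$, assumed irreducible. Suppose $M$ contains an element acting as a constant map on $\Omega$ (e.g. if the minimal ideal of $M$ is aperiodic). Then: (1) $\mathcal M$ is ergodic. (2) Let $L$ be a minimal left ideal of $M$, let $\mu$ be the stationary distribution of the random walk of $M$ on $L$ (by left multiplication) driven by $P$, and let $\pi$ be the stationary distribution of $\mathcal M$. Then for all $\omega\in\Omega$, $$\pi(\omega)=\sum_{\{x\in L\,:\,x\omega=\omega\}}\mu(x).$$ (3) Let $I$ be the ideal of elements of $M$ acting as constant maps on $\Omega$. Then for every probability distribution $\nu$ on $\Omega$ and every $n\ge0$, $$\|T^n\nu-\pi\|_{TV}\le P^{\ast n}(M\setminus I).$$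
   Context: The random walk of $M$ on $\Omega$ driven by a probability $P$ on $M$ is the Markov chain with state set $\Omega$ and column-stochastic transition matrix $T(\alpha,\beta)=\sum_{m\in M,\,m\beta=\alpha}P(m)$ (probability of moving from $\beta$ to $\alpha$); $T$ acts on probability vectors $\nu$ by $(T\nu)(\alpha)=\sum_\beta T(\alpha,\beta)\nu(\beta)$. The chain is irreducible if for all $\alpha,\beta$ there is $n\ge0$ with $T^n(\alpha,\beta)>0$, and ergodic if some power $T^n$ has all entries positive. $P$ is adapted if the submonoid generated by $\{m:P(m)>0\}$ contains the minimal two-sided ideal of $M$. A finite semigroup is aperiodic if $s^n=s^{n+1}$ for all $s$ and some $n$. $P^{\ast n}$ is the $n$-th convolution power, where $(f\ast g)(m)=\sum_{xy=m}f(x)g(y)$, and $P(A)=\sum_{m\in A}P(m)$. The total variation distance is $\|\nu-\mu\|_{TV}=\max_{A\subseteq\Omega}|\nu(A)-\mu(A)|$. -}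

module Defs where

open import Level using (0ℓ)
open import Data.Nat using (ℕ; zero; suc)
open import Data.Fin using (Fin; zero; suc; _≟_)
open import Data.Fin.Subset using (Subset; _∈_; _∉_; _⊆_; Nonempty; inside; outside)
open import Data.Fin.Subset.Properties using (_∈?_)
open import Data.Fin.Properties using (all?)
open import Data.Vec using (_∷_; [])
open import Data.List using (List; _++_; map; foldr) renaming ([] to []ˡ; _∷_ to _∷ˡ_)
open import Data.Product using (_×_; ∃; _,_)
open import Relation.Nullary using (¬_; Dec; yes; no; ¬?)
open import Relation.Binary using (IsTotalOrder; Decidable)
open import Relation.Binary.PropositionalEquality using (_≡_)
open import Algebra.Bundles using (CommutativeRing)

record OrderedField : Set₁ where
  field
    commutativeRing : CommutativeRing 0ℓ 0ℓ
  open CommutativeRing commutativeRing public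
    using (Carrier; _≈_; _+_; _*_; -_; _-_; 0#; 1#; isCommutativeRing)
  field
    _≤_          : Carrier → Carrier → Set
    isTotalOrder : IsTotalOrder _≈_ _≤_
    _≤?_         : Decidable _≤_
    +-monoʳ      : ∀ {x y} z → x ≤ y → (x + z) ≤ (y + z)
    *-nonneg     : ∀ {x y} → 0# ≤ x → 0# ≤ y → 0# ≤ (x * y)
    0≉1          : ¬ (0# ≈ 1#)
    inverse      : ∀ x → ¬ (x ≈ 0#) → ∃ λ y → (x * y) ≈ 1#

  _<_ : Carrier → Carrier → Set
  x < y = (x ≤ y) × ¬ (x ≈ y)

  ∣_∣ : Carrier → Carrier
  ∣ x ∣ with x ≤? 0#
  ... | yes _ = - x
  ... | no  _ = x

  max : Carrier → Carrier → Carrier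
  max x y with x ≤? y
  ... | yes _ = y
  ... | no  _ = x

  sumF : ∀ {n} → (Fin n → Carrier) → Carrier
  sumF {zero}  f = 0#
  sumF {suc n} f = f zero + sumF (λ i → f (suc i))

  ind : ∀ {a} {X : Set a} → Dec X → Carrier → Carrier
  ind (yes _) c = c
  ind (no  _) c = 0#

  IsProbability : ∀ {n} → (Fin n → Carrier) → Set
  IsProbability p = (∀ i → 0# ≤ p i) × (sumF p ≈ 1#)

record FiniteMonoid : Set where
  field
    size      : ℕ
    _∙_       : Fin size → Fin size → Fin size
    e         : Fin size
    assoc     : ∀ x y z → ((x ∙ y) ∙ z) ≡ (x ∙ (y ∙ z))
    identityˡ : ∀ x → (e ∙ x) ≡ x
    identityʳ : ∀ x → (x ∙ e) ≡ x

record Action (M : FiniteMonoid) (k : ℕ) : Set where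
  open FiniteMonoid M
  field
    act   : Fin size → Fin k → Fin k
    act-e : ∀ ω → act e ω ≡ ω
    act-∙ : ∀ a b ω → act (a ∙ b) ω ≡ act a (act b ω)

allSubsets : ∀ n → List (Subset n)
allSubsets zero    = [] ∷ˡ []ˡ
allSubsets (suc n) = map (inside ∷_) (allSubsets n) ++ map (outside ∷_) (allSubsets n)

module Walk (F : OrderedField) (M : FiniteMonoid) {k : ℕ} (A : Action M k)
            (P : Fin (FiniteMonoid.size M) → OrderedField.Carrier F) where
  open OrderedField F
  open FiniteMonoid M
  open Action A

  T : Fin k → Fin k → Carrier
  T α β = sumF λ m → ind (act m β ≟ α) (P m)

  Tpow : ℕ → Fin k → Fin k → Carrier
  Tpow zero    α β = ind (α ≟ β) 1#
  Tpow (suc n) α β = sumF λ γ → T α γ * Tpow n γ β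

  Irreducible : Set
  Irreducible = ∀ α β → ∃ λ n → 0# < Tpow n α β

  Ergodic : Set
  Ergodic = ∃ λ n → ∀ α β → 0# < Tpow n α β

  step : (Fin k → Carrier) → Fin k → Carrier
  step ν α = sumF λ β → T α β * ν β

  stepN : ℕ → (Fin k → Carrier) → Fin k → Carrier
  stepN zero    ν = ν
  stepN (suc n) ν = step (stepN n ν)

  Stationary : (Fin k → Carrier) → Set
  Stationary π = IsProbability π × (∀ α → step π α ≈ π α)

  data Gen : Fin size → Set where
    gen-e : Gen e
    gen-∙ : ∀ {a b} → 0# < P a → Gen b → Gen (a ∙ b)

  IsIdeal : Subset size → Set
  IsIdeal S = Nonempty S × (∀ x y → x ∈ S → ((y ∙ x) ∈ S) × ((x ∙ y) ∈ S))

  IsMinimalIdeal : Subset size → Set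
  IsMinimalIdeal S = IsIdeal S × (∀ J → IsIdeal J → J ⊆ S → S ⊆ J)

  Adapted : Set
  Adapted = ∀ K → IsMinimalIdeal K → ∀ x → x ∈ K → Gen x

  IsLeftIdeal : Subset size → Set
  IsLeftIdeal L = Nonempty L × (∀ x y → x ∈ L → (y ∙ x) ∈ L)

  IsMinimalLeftIdeal : Subset size → Set
  IsMinimalLeftIdeal L = IsLeftIdeal L × (∀ J → IsLeftIdeal J → J ⊆ L → L ⊆ J)

  -- one step of the random walk of M on L by left multiplication
  -- (distributions on L represented as functions on M vanishing off L)
  stepL : (Fin size → Carrier) → Fin size → Carrier
  stepL μ y = sumF λ x → sumF λ a → ind ((a ∙ x) ≟ y) (P a * μ x)

  StationaryOn : Subset size → (Fin size → Carrier) → Set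
  StationaryOn L μ = IsProbability μ × (∀ x → x ∉ L → μ x ≈ 0#)
                     × (∀ y → y ∈ L → stepL μ y ≈ μ y)

  IsConstant : Fin size → Set
  IsConstant z = ∀ ω ω′ → act z ω ≡ act z ω′

  isConstant? : ∀ z → Dec (IsConstant z)
  isConstant? z = all? λ ω → all? λ ω′ → act z ω ≟ act z ω′

  conv : (Fin size → Carrier) → (Fin size → Carrier) → Fin size → Carrier
  conv f g m = sumF λ x → sumF λ y → ind ((x ∙ y) ≟ m) (f x * g y)

  convPow : ℕ → Fin size → Carrier
  convPow zero    m = ind (m ≟ e) 1#
  convPow (suc n) m = conv P (convPow n) m

  massOutsideI : ℕ → Carrier
  massOutsideI n = sumF λ m → ind (¬? (isConstant? m)) (convPow n m)

  measure : (Fin k → Carrier) → Subset k → Carrier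
  measure ν S = sumF λ α → ind (α ∈? S) (ν α)

  tv : (Fin k → Carrier) → (Fin k → Carrier) → Carrier
  tv ν μ = foldr (λ S r → max ∣ measure ν S - measure μ S ∣ r) 0# (allSubsets k)

-- Constant maps on Ω form an ideal, so the minimal ideal consists of constant maps, and adaptedness
-- makes one of them, g, a product of steps of positive probability. Every state therefore reaches the
-- image of g in a fixed number of steps, and irreducibility then gives ergodicity. Writing
-- T^n ν = Σ_m P^{*n}(m) m_* ν, the terms with m ∈ I are the same point mass for every ν, so they
-- cancel in T^n ν - π, and the remaining ones have total variation at most P^{*n}(M \ I). Finally,
-- pushing μ forward along x ↦ x ω gives a stationary distribution of the walk on Ω, which equals π
-- because an irreducible chain has only one.
module Submission where

open import Defs
open import Data.Nat as ℕ using (ℕ; zero; suc; _∸_; _⊔_) renaming (_+_ to _+ℕ_; _≤_ to _≤ℕ_)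
import Data.Nat.Properties as ℕ
open import Data.Fin using (Fin; zero; suc; _≟_)
open import Data.Fin.Properties using (suc-injective; any?)
open import Data.Fin.Subset using (Subset; _∈_; _⊆_; inside; outside) renaming (∣_∣ to card)
open import Data.Fin.Subset.Properties using (_∈?_; p⊂q⇒∣p∣<∣q∣)
open import Data.Vec using ([]; _∷_; here; there)
open import Data.List using (List; foldr) renaming ([] to []ˡ; _∷_ to _∷ˡ_)
open import Data.Product using (_×_; ∃; _,_; proj₁; proj₂)
open import Data.Sum using (inj₁; inj₂)
open import Data.Unit using (tt)
open import Data.Empty using (⊥-elim)
open import Function using (_∘_)
open import Relation.Nullary using (¬_; Dec; yes; no; ¬?)
open import Relation.Nullary.Decidable using (_×-dec_)
open import Relation.Binary using (TotalPreorder; TotalOrder)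
open import Relation.Binary.PropositionalEquality as ≡ using (_≡_)
open import Algebra.Bundles using (CommutativeRing)

module OrderedFieldProperties (F : OrderedField) where
  open OrderedField F
  open CommutativeRing commutativeRing public
    using (setoid; refl; sym; trans; +-cong; +-congˡ; +-congʳ; *-congˡ; *-congʳ;
           +-assoc; +-comm; *-assoc; *-comm; +-identityˡ; +-identityʳ;
           *-identityˡ; *-identityʳ; -‿inverseˡ; -‿inverseʳ; -‿cong;
           zeroˡ; zeroʳ; distribˡ; +-abelianGroup; ring)
  open import Algebra.Properties.Ring ring public using (-‿distribˡ-*; -1*x≈-x; x[y-z]≈xy-xz)
  open import Algebra.Properties.AbelianGroup +-abelianGroup public
    using (⁻¹-∙-comm; ⁻¹-involutive; ε⁻¹≈ε; x∙y⁻¹≈ε⇒x≈y)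
  open import Relation.Binary using (IsTotalOrder)
  open IsTotalOrder isTotalOrder public
    using (antisym; total; reflexive; ≤-respˡ-≈; ≤-respʳ-≈)
    renaming (trans to ≤-trans; refl to ≤-refl)
  open import Relation.Binary.Reasoning.Setoid setoid public

  totalOrder : TotalOrder _ _ _
  totalOrder = record { isTotalOrder = isTotalOrder }

  ≡⇒≈ : ∀ {x y} → x ≡ y → x ≈ y
  ≡⇒≈ ≡.refl = refl

  +-monoˡ : ∀ {x y} z → x ≤ y → (z + x) ≤ (z + y)
  +-monoˡ {x} {y} z p = ≤-respʳ-≈ (+-comm y z) (≤-respˡ-≈ (+-comm x z) (+-monoʳ z p))

  +-mono : ∀ {a b c d} → a ≤ b → c ≤ d → (a + c) ≤ (b + d)
  +-mono {a} {b} {c} p q = ≤-trans (+-monoʳ c p) (+-monoˡ b q)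

  +-nonneg : ∀ {a b} → 0# ≤ a → 0# ≤ b → 0# ≤ (a + b)
  +-nonneg p q = ≤-respˡ-≈ (+-identityʳ 0#) (+-mono p q)

  x≤x+y : ∀ x {y} → 0# ≤ y → x ≤ (x + y)
  x≤x+y x 0≤y = ≤-respˡ-≈ (+-identityʳ x) (+-monoˡ x 0≤y)

  x≤y⇒0≤y-x : ∀ {x y} → x ≤ y → 0# ≤ (y - x)
  x≤y⇒0≤y-x {x} p = ≤-respˡ-≈ (-‿inverseʳ x) (+-monoʳ (- x) p)

  0≤y-x⇒x≤y : ∀ {x y} → 0# ≤ (y - x) → x ≤ y
  0≤y-x⇒x≤y {x} {y} p = ≤-respʳ-≈ y-x+x≈y (≤-respˡ-≈ (+-identityˡ x) (+-monoʳ x p))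
    where
    y-x+x≈y : ((y - x) + x) ≈ y
    y-x+x≈y = begin
      (y - x) + x   ≈⟨ +-assoc y (- x) x ⟩
      y + (- x + x) ≈⟨ +-congˡ (-‿inverseˡ x) ⟩
      y + 0#        ≈⟨ +-identityʳ y ⟩
      y             ∎

  -‿antitone : ∀ {a b} → a ≤ b → (- b) ≤ (- a)
  -‿antitone {a} {b} p = 0≤y-x⇒x≤y (≤-respʳ-≈ b-a≈-a-[-b] (x≤y⇒0≤y-x p))
    where
    b-a≈-a-[-b] : (b - a) ≈ (- a - - b)
    b-a≈-a-[-b] = trans (+-comm b (- a)) (+-congˡ (sym (⁻¹-involutive b)))

  *-monoˡ-nonneg : ∀ {a b} c → 0# ≤ c → a ≤ b → (c * a) ≤ (c * b)
  *-monoˡ-nonneg {a} {b} c q p = 0≤y-x⇒x≤y (≤-respʳ-≈ c[b-a]≈cb-ca (*-nonneg q (x≤y⇒0≤y-x p)))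
    where
    c[b-a]≈cb-ca : (c * (b - a)) ≈ (c * b - c * a)
    c[b-a]≈cb-ca = trans (distribˡ c b (- a))
                     (+-congˡ (trans (*-comm c (- a)) (trans (sym (-‿distribˡ-* a c)) (-‿cong (*-comm a c)))))

  *-monoʳ-nonneg : ∀ {a b} c → 0# ≤ c → a ≤ b → (a * c) ≤ (b * c)
  *-monoʳ-nonneg {a} {b} c q p = ≤-respʳ-≈ (*-comm c b) (≤-respˡ-≈ (*-comm c a) (*-monoˡ-nonneg c q p))

  -- If 1 ≤ 0 then - 1 is nonnegative and 1 ≈ - 1 * - 1.
  0≤1 : 0# ≤ 1#
  0≤1 with total 0# 1#
  ... | inj₁ p = p
  ... | inj₂ p = ≤-respʳ-≈ -1*-1≈1 (*-nonneg 0≤-1 0≤-1)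
    where
    0≤-1 : 0# ≤ (- 1#)
    0≤-1 = ≤-respˡ-≈ ε⁻¹≈ε (-‿antitone p)
    -1*-1≈1 : (- 1# * - 1#) ≈ 1#
    -1*-1≈1 = trans (-1*x≈-x (- 1#)) (⁻¹-involutive 1#)

  0<1 : 0# < 1#
  0<1 = 0≤1 , 0≉1

  ≈0? : ∀ x → Dec (x ≈ 0#)
  ≈0? x with x ≤? 0# | 0# ≤? x
  ... | yes p | yes q = yes (antisym p q)
  ... | no ¬p | _     = no λ x≈0 → ¬p (reflexive x≈0)
  ... | _     | no ¬q = no λ x≈0 → ¬q (reflexive (sym x≈0))

  x≉0∧xy≈0⇒y≈0 : ∀ {x y} → ¬ (x ≈ 0#) → (x * y) ≈ 0# → y ≈ 0#
  x≉0∧xy≈0⇒y≈0 {x} {y} x≉0 xy≈0 with inverse x x≉0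
  ... | x⁻¹ , xx⁻¹≈1 = begin
    y              ≈⟨ sym (*-identityˡ y) ⟩
    1# * y         ≈⟨ *-congʳ (trans (sym xx⁻¹≈1) (*-comm x x⁻¹)) ⟩
    (x⁻¹ * x) * y  ≈⟨ *-assoc x⁻¹ x y ⟩
    x⁻¹ * (x * y)  ≈⟨ *-congˡ xy≈0 ⟩
    x⁻¹ * 0#       ≈⟨ zeroʳ x⁻¹ ⟩
    0#             ∎

  *-pos : ∀ {a b} → 0# < a → 0# < b → 0# < (a * b)
  *-pos (p , a≉0) (q , b≉0) =
    *-nonneg p q , λ 0≈ab → b≉0 (sym (x≉0∧xy≈0⇒y≈0 (a≉0 ∘ sym) (sym 0≈ab)))

  *-pos⁻ˡ : ∀ {a b} → 0# ≤ a → 0# < (a * b) → 0# < a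
  *-pos⁻ˡ {a} {b} p (_ , 0≉ab) = p , λ 0≈a → 0≉ab (sym (trans (*-congʳ (sym 0≈a)) (zeroˡ b)))

  *-pos⁻ʳ : ∀ {a b} → 0# ≤ b → 0# < (a * b) → 0# < b
  *-pos⁻ʳ {a} {b} p (_ , 0≉ab) = p , λ 0≈b → 0≉ab (sym (trans (*-congˡ (sym 0≈b)) (zeroʳ a)))

  infix 4 _within±_
  _within±_ : Carrier → Carrier → Set
  x within± c = ((- c) ≤ x) × (x ≤ c)

  within±-respˡ-≈ : ∀ {x y c} → x ≈ y → y within± c → x within± c
  within±-respˡ-≈ x≈y (lo , hi) = ≤-respʳ-≈ (sym x≈y) lo , ≤-respˡ-≈ (sym x≈y) hi

  ≈0-within±0 : ∀ {x} → x ≈ 0# → x within± 0#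
  ≈0-within±0 x≈0 = within±-respˡ-≈ x≈0 (≤-respˡ-≈ (sym ε⁻¹≈ε) ≤-refl , ≤-refl)

  x-y-within±1 : ∀ {x y} → 0# ≤ x → x ≤ 1# → 0# ≤ y → y ≤ 1# → (x - y) within± 1#
  x-y-within±1 {x} {y} 0≤x x≤1 0≤y y≤1 =
    ≤-trans (-‿antitone y≤1) (≤-respʳ-≈ (+-comm (- y) x) (x≤x+y (- y) 0≤x)) ,
    ≤-trans (≤-respʳ-≈ (+-identityʳ x) (+-monoˡ x (≤-respʳ-≈ ε⁻¹≈ε (-‿antitone 0≤y)))) x≤1

  *-within± : ∀ {c d} → 0# ≤ c → d within± 1# → (c * d) within± c
  *-within± {c} 0≤c (lo , hi) =
    ≤-respˡ-≈ (trans (*-comm c (- 1#)) (-1*x≈-x c)) (*-monoˡ-nonneg c 0≤c lo) ,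
    ≤-respʳ-≈ (*-identityʳ c) (*-monoˡ-nonneg c 0≤c hi)

  within±⇒∣∣≤ : ∀ {x c} → x within± c → ∣ x ∣ ≤ c
  within±⇒∣∣≤ {x} {c} (lo , hi) with x ≤? 0#
  ... | yes _ = ≤-respʳ-≈ (⁻¹-involutive c) (-‿antitone lo)
  ... | no  _ = hi

  max-lub : ∀ {a b c} → a ≤ c → b ≤ c → max a b ≤ c
  max-lub {a} {b} p q with a ≤? b
  ... | yes _ = q
  ... | no  _ = p

  foldr-max-lub : ∀ {A : Set} (f : A → Carrier) {c} (xs : List A) → 0# ≤ c → (∀ x → f x ≤ c) →
                  foldr (λ x r → max (f x) r) 0# xs ≤ c
  foldr-max-lub f []ˡ       0≤c f≤c = 0≤c
  foldr-max-lub f (x ∷ˡ xs) 0≤c f≤c = max-lub (f≤c x) (foldr-max-lub f xs 0≤c f≤c)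

  sumF-cong : ∀ {n} {f g : Fin n → Carrier} → (∀ i → f i ≈ g i) → sumF f ≈ sumF g
  sumF-cong {zero}  f≈g = refl
  sumF-cong {suc n} f≈g = +-cong (f≈g zero) (sumF-cong (f≈g ∘ suc))

  sumF-zero : ∀ {n} {f : Fin n → Carrier} → (∀ i → f i ≈ 0#) → sumF f ≈ 0#
  sumF-zero {zero}  f≈0 = refl
  sumF-zero {suc n} f≈0 = trans (+-cong (f≈0 zero) (sumF-zero (f≈0 ∘ suc))) (+-identityʳ 0#)

  sumF-+ : ∀ {n} (f g : Fin n → Carrier) → sumF (λ i → f i + g i) ≈ (sumF f + sumF g)
  sumF-+ {zero}  f g = sym (+-identityʳ 0#)
  sumF-+ {suc n} f g = begin
    (f zero + g zero) + sumF (λ i → f (suc i) + g (suc i))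
      ≈⟨ +-congˡ (sumF-+ (f ∘ suc) (g ∘ suc)) ⟩
    (f zero + g zero) + (F′ + G′)  ≈⟨ +-assoc (f zero) (g zero) (F′ + G′) ⟩
    f zero + (g zero + (F′ + G′))  ≈⟨ +-congˡ (sym (+-assoc (g zero) F′ G′)) ⟩
    f zero + ((g zero + F′) + G′)  ≈⟨ +-congˡ (+-congʳ (+-comm (g zero) F′)) ⟩
    f zero + ((F′ + g zero) + G′)  ≈⟨ +-congˡ (+-assoc F′ (g zero) G′) ⟩
    f zero + (F′ + (g zero + G′))  ≈⟨ sym (+-assoc (f zero) F′ (g zero + G′)) ⟩
    (f zero + F′) + (g zero + G′)  ∎
    where
    F′ = sumF (f ∘ suc)
    G′ = sumF (g ∘ suc)

  sumF-*ˡ : ∀ {n} c (f : Fin n → Carrier) → sumF (λ i → c * f i) ≈ (c * sumF f)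
  sumF-*ˡ {zero}  c f = sym (zeroʳ c)
  sumF-*ˡ {suc n} c f = trans (+-congˡ (sumF-*ˡ c (f ∘ suc))) (sym (distribˡ c (f zero) _))

  sumF-*ʳ : ∀ {n} c (f : Fin n → Carrier) → sumF (λ i → f i * c) ≈ (sumF f * c)
  sumF-*ʳ c f = trans (sumF-cong (λ i → *-comm (f i) c)) (trans (sumF-*ˡ c f) (*-comm c (sumF f)))

  sumF-neg : ∀ {n} (f : Fin n → Carrier) → sumF (λ i → - f i) ≈ (- sumF f)
  sumF-neg {zero}  f = sym ε⁻¹≈ε
  sumF-neg {suc n} f = trans (+-congˡ (sumF-neg (f ∘ suc))) (⁻¹-∙-comm (f zero) _)

  sumF-sub : ∀ {n} (f g : Fin n → Carrier) → sumF (λ i → f i - g i) ≈ (sumF f - sumF g)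
  sumF-sub f g = trans (sumF-+ f (λ i → - g i)) (+-congˡ (sumF-neg g))

  sumF-swap : ∀ {m n} (f : Fin m → Fin n → Carrier) →
              sumF (λ i → sumF (λ j → f i j)) ≈ sumF (λ j → sumF (λ i → f i j))
  sumF-swap {zero} {n} f = sym (sumF-zero {n} (λ _ → refl))
  sumF-swap {suc m} f =
    trans (+-congˡ (sumF-swap (f ∘ suc))) (sym (sumF-+ (f zero) (λ j → sumF (λ i → f (suc i) j))))

  sumF-mono : ∀ {n} {f g : Fin n → Carrier} → (∀ i → f i ≤ g i) → sumF f ≤ sumF g
  sumF-mono {zero}  f≤g = ≤-refl
  sumF-mono {suc n} f≤g = +-mono (f≤g zero) (sumF-mono (f≤g ∘ suc))

  sumF-within± : ∀ {n} {f g : Fin n → Carrier} → (∀ i → f i within± g i) → sumF f within± sumF g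
  sumF-within± {f = f} {g} f-within =
    ≤-respˡ-≈ (sumF-neg g) (sumF-mono (proj₁ ∘ f-within)) , sumF-mono (proj₂ ∘ f-within)

  sumF-nonneg : ∀ {n} {f : Fin n → Carrier} → (∀ i → 0# ≤ f i) → 0# ≤ sumF f
  sumF-nonneg {zero}  0≤f = ≤-refl
  sumF-nonneg {suc n} 0≤f = +-nonneg (0≤f zero) (sumF-nonneg (0≤f ∘ suc))

  f≤sumF : ∀ {n} {f : Fin n → Carrier} → (∀ i → 0# ≤ f i) → ∀ j → f j ≤ sumF f
  f≤sumF {suc n} 0≤f zero    = x≤x+y _ (sumF-nonneg (0≤f ∘ suc))
  f≤sumF {suc n} 0≤f (suc j) =
    ≤-trans (f≤sumF (0≤f ∘ suc) j) (≤-respˡ-≈ (+-identityˡ _) (+-monoʳ _ (0≤f zero)))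

  sumF-pos : ∀ {n} {f : Fin n → Carrier} → (∀ i → 0# ≤ f i) → ∀ j → 0# < f j → 0# < sumF f
  sumF-pos 0≤f j (_ , 0≉fj) =
    sumF-nonneg 0≤f , λ 0≈Σf → 0≉fj (antisym (0≤f j) (≤-respʳ-≈ (sym 0≈Σf) (f≤sumF 0≤f j)))

  sumF-pos⁻ : ∀ {n} {f : Fin n → Carrier} → (∀ i → 0# ≤ f i) → 0# < sumF f → ∃ λ j → 0# < f j
  sumF-pos⁻ {zero}  0≤f (_ , 0≉0) = ⊥-elim (0≉0 refl)
  sumF-pos⁻ {suc n} {f} 0≤f 0<Σf with ≈0? (f zero)
  ... | no f0≉0 = zero , 0≤f zero , f0≉0 ∘ sym
  ... | yes f0≈0 with sumF-pos⁻ (0≤f ∘ suc) (sumF-nonneg (0≤f ∘ suc) , 0≉Σf′)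
    where
    0≉Σf′ : ¬ (0# ≈ sumF (f ∘ suc))
    0≉Σf′ 0≈Σf′ = proj₂ 0<Σf (sym (trans (+-cong f0≈0 (sym 0≈Σf′)) (+-identityʳ 0#)))
  ... | j , 0<fj = suc j , 0<fj

  probability-support : ∀ {n} {f : Fin n → Carrier} → IsProbability f → ∃ λ i → 0# < f i
  probability-support (0≤f , Σf≈1) = sumF-pos⁻ 0≤f (≤-respʳ-≈ (sym Σf≈1) 0≤1 , λ 0≈Σf → 0≉1 (trans 0≈Σf Σf≈1))

  sumF≈0⇒f≈0 : ∀ {n} {f : Fin n → Carrier} → (∀ i → 0# ≤ f i) → sumF f ≈ 0# → ∀ j → f j ≈ 0#
  sumF≈0⇒f≈0 0≤f Σf≈0 j = antisym (≤-respʳ-≈ Σf≈0 (f≤sumF 0≤f j)) (0≤f j)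

  sumF-single : ∀ {n} (f : Fin n → Carrier) j → (∀ i → ¬ i ≡ j → f i ≈ 0#) → sumF f ≈ f j
  sumF-single {suc n} f zero    f≈0 =
    trans (+-congˡ (sumF-zero (λ i → f≈0 (suc i) λ ()))) (+-identityʳ (f zero))
  sumF-single {suc n} f (suc j) f≈0 =
    trans (+-cong (f≈0 zero λ ()) (sumF-single (f ∘ suc) j (λ i i≢j → f≈0 (suc i) (i≢j ∘ suc-injective))))
          (+-identityˡ (f (suc j)))

  ind-nonneg : ∀ {a} {X : Set a} (d : Dec X) {c} → 0# ≤ c → 0# ≤ ind d c
  ind-nonneg (yes _) 0≤c = 0≤c
  ind-nonneg (no  _) 0≤c = ≤-refl

  ind-≤ : ∀ {a} {X : Set a} (d : Dec X) {c} → 0# ≤ c → ind d c ≤ c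
  ind-≤ (yes _) 0≤c = ≤-refl
  ind-≤ (no  _) 0≤c = 0≤c

  ind-cong : ∀ {a} {X : Set a} (d : Dec X) {x y} → x ≈ y → ind d x ≈ ind d y
  ind-cong (yes _) x≈y = x≈y
  ind-cong (no  _) x≈y = refl

  ind-0 : ∀ {a} {X : Set a} (d : Dec X) → ind d 0# ≈ 0#
  ind-0 (yes _) = refl
  ind-0 (no  _) = refl

  ind-*ˡ : ∀ {a} {X : Set a} (d : Dec X) x y → (x * ind d y) ≈ ind d (x * y)
  ind-*ˡ (yes _) x y = refl
  ind-*ˡ (no  _) x y = zeroʳ x

  ind-*ʳ : ∀ {a} {X : Set a} (d : Dec X) x y → (ind d x * y) ≈ ind d (x * y)
  ind-*ʳ (yes _) x y = refl
  ind-*ʳ (no  _) x y = zeroˡ y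

  ind-sumF : ∀ {a} {X : Set a} (d : Dec X) {n} (f : Fin n → Carrier) →
             ind d (sumF f) ≈ sumF (λ i → ind d (f i))
  ind-sumF (yes _) f = refl
  ind-sumF (no  _) {n} f = sym (sumF-zero {n} (λ _ → refl))

  ind-yes : ∀ {a} {X : Set a} (d : Dec X) → X → ∀ c → ind d c ≡ c
  ind-yes (yes _) x c = ≡.refl
  ind-yes (no ¬x) x c = ⊥-elim (¬x x)

  ind-no : ∀ {a} {X : Set a} (d : Dec X) → ¬ X → ∀ c → ind d c ≡ 0#
  ind-no (yes x) ¬x c = ⊥-elim (¬x x)
  ind-no (no  _) ¬x c = ≡.refl

  ind-comm : ∀ {a b} {X : Set a} {Y : Set b} (d : Dec X) (d′ : Dec Y) c → ind d (ind d′ c) ≡ ind d′ (ind d c)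
  ind-comm (yes _) d′ c = ≡.refl
  ind-comm (no  _) (yes _) c = ≡.refl
  ind-comm (no  _) (no  _) c = ≡.refl

  ind-× : ∀ {a b} {X : Set a} {Y : Set b} (d : Dec X) (d′ : Dec Y) c → ind (d ×-dec d′) c ≡ ind d (ind d′ c)
  ind-× (yes _) (yes _) c = ≡.refl
  ind-× (yes _) (no  _) c = ≡.refl
  ind-× (no  _) _       c = ≡.refl

  sumF-ind-≟ : ∀ {n} (j : Fin n) (f : Fin n → Carrier) → sumF (λ i → ind (i ≟ j) (f i)) ≈ f j
  sumF-ind-≟ j f = trans (sumF-single _ j (λ i i≢j → ≡⇒≈ (ind-no (i ≟ j) i≢j (f i))))
                         (≡⇒≈ (ind-yes (j ≟ j) ≡.refl (f j)))

  sumF-≟-ind : ∀ {n} (j : Fin n) (f : Fin n → Carrier) → sumF (λ i → ind (j ≟ i) (f i)) ≈ f j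
  sumF-≟-ind j f = trans (sumF-single _ j (λ i i≢j → ≡⇒≈ (ind-no (j ≟ i) (i≢j ∘ ≡.sym) (f i))))
                         (≡⇒≈ (ind-yes (j ≟ j) ≡.refl (f j)))

  sumF-ind-*ˡ : ∀ {n} {a} {X : Fin n → Set a} (d : ∀ i → Dec (X i)) c (f : Fin n → Carrier) →
                sumF (λ i → ind (d i) (c * f i)) ≈ (c * sumF (λ i → ind (d i) (f i)))
  sumF-ind-*ˡ d c f = trans (sumF-cong (λ i → sym (ind-*ˡ (d i) c (f i)))) (sumF-*ˡ c (λ i → ind (d i) (f i)))

  sumF-ind-mixture : ∀ {m n} {a} {X : Fin n → Set a} (d : ∀ i → Dec (X i))
                     (c : Fin m → Carrier) (f : Fin m → Fin n → Carrier) →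
                     sumF (λ i → ind (d i) (sumF (λ x → c x * f x i)))
                       ≈ sumF (λ x → c x * sumF (λ i → ind (d i) (f x i)))
  sumF-ind-mixture d c f = begin
    sumF (λ i → ind (d i) (sumF (λ x → c x * f x i)))
      ≈⟨ sumF-cong (λ i → ind-sumF (d i) (λ x → c x * f x i)) ⟩
    sumF (λ i → sumF (λ x → ind (d i) (c x * f x i)))
      ≈⟨ sumF-swap (λ i x → ind (d i) (c x * f x i)) ⟩
    sumF (λ x → sumF (λ i → ind (d i) (c x * f x i)))
      ≈⟨ sumF-cong (λ x → sumF-ind-*ˡ d (c x) (f x)) ⟩
    sumF (λ x → c x * sumF (λ i → ind (d i) (f x i))) ∎

  push : ∀ {m n} → (Fin m → Fin n) → (Fin m → Carrier) → Fin n → Carrier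
  push φ f y = sumF λ i → ind (φ i ≟ y) (f i)

  module _ {m n} (φ : Fin m → Fin n) where

    sumF-ind-push : ∀ {a} {X : Fin n → Set a} (d : ∀ y → Dec (X y)) (f : Fin m → Carrier) →
                    sumF (λ y → ind (d y) (push φ f y)) ≈ sumF (λ i → ind (d (φ i)) (f i))
    sumF-ind-push d f = begin
      sumF (λ y → ind (d y) (sumF λ i → ind (φ i ≟ y) (f i)))
        ≈⟨ sumF-cong (λ y → ind-sumF (d y) (λ i → ind (φ i ≟ y) (f i))) ⟩
      sumF (λ y → sumF λ i → ind (d y) (ind (φ i ≟ y) (f i)))
        ≈⟨ sumF-swap (λ y i → ind (d y) (ind (φ i ≟ y) (f i))) ⟩
      sumF (λ i → sumF λ y → ind (d y) (ind (φ i ≟ y) (f i)))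
        ≈⟨ sumF-cong (λ i → sumF-cong (λ y → ≡⇒≈ (ind-comm (d y) (φ i ≟ y) (f i)))) ⟩
      sumF (λ i → sumF λ y → ind (φ i ≟ y) (ind (d y) (f i)))
        ≈⟨ sumF-cong (λ i → sumF-≟-ind (φ i) (λ y → ind (d y) (f i))) ⟩
      sumF (λ i → ind (d (φ i)) (f i)) ∎

    sumF-push : (f : Fin m → Carrier) → sumF (push φ f) ≈ sumF f
    sumF-push = sumF-ind-push (λ _ → yes tt)

    sumF-push-* : (f : Fin m → Carrier) (g : Fin n → Carrier) →
                  sumF (λ y → push φ f y * g y) ≈ sumF (λ i → f i * g (φ i))
    sumF-push-* f g = begin
      sumF (λ y → push φ f y * g y)
        ≈⟨ sumF-cong (λ y → sym (sumF-*ʳ (g y) (λ i → ind (φ i ≟ y) (f i)))) ⟩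
      sumF (λ y → sumF λ i → ind (φ i ≟ y) (f i) * g y)
        ≈⟨ sumF-swap (λ y i → ind (φ i ≟ y) (f i) * g y) ⟩
      sumF (λ i → sumF λ y → ind (φ i ≟ y) (f i) * g y)
        ≈⟨ sumF-cong (λ i → trans (sumF-cong (λ y → ind-*ʳ (φ i ≟ y) (f i) (g y)))
                                  (sumF-≟-ind (φ i) (λ y → f i * g y))) ⟩
      sumF (λ i → f i * g (φ i)) ∎

    push-cong : ∀ {f g : Fin m → Carrier} → (∀ i → f i ≈ g i) → ∀ y → push φ f y ≈ push φ g y
    push-cong f≈g y = sumF-cong (λ i → ind-cong (φ i ≟ y) (f≈g i))

    push-mixture : ∀ {l} (c : Fin l → Carrier) (f : Fin l → Fin m → Carrier) y →
                   push φ (λ i → sumF (λ x → c x * f x i)) y ≈ sumF (λ x → c x * push φ (f x) y)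
    push-mixture c f y = sumF-ind-mixture (λ i → φ i ≟ y) c f

    push-probability : ∀ {f} → IsProbability f → IsProbability (push φ f)
    push-probability (0≤f , Σf≈1) =
      (λ y → sumF-nonneg (λ i → ind-nonneg (φ i ≟ y) (0≤f i))) , trans (sumF-push _) Σf≈1

    push-constant : (∀ i j → φ i ≡ φ j) → ∀ {f} → sumF f ≈ 1# → ∀ b y → push φ f y ≈ ind (φ b ≟ y) 1#
    push-constant φ-const {f} Σf≈1 b y = begin
      sumF (λ i → ind (φ i ≟ y) (f i))  ≈⟨ sumF-cong (λ i → ≡⇒≈ (≡.cong (λ z → ind (z ≟ y) (f i)) (φ-const i b))) ⟩
      sumF (λ i → ind (φ b ≟ y) (f i))  ≈⟨ sym (ind-sumF (φ b ≟ y) f) ⟩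
      ind (φ b ≟ y) (sumF f)            ≈⟨ ind-cong (φ b ≟ y) Σf≈1 ⟩
      ind (φ b ≟ y) 1#                  ∎

  push-∘ : ∀ {l m n} (ψ : Fin m → Fin n) (φ : Fin l → Fin m) f z → push ψ (push φ f) z ≈ push (ψ ∘ φ) f z
  push-∘ ψ φ f z = sumF-ind-push φ (λ y → ψ y ≟ z) f

  push-≗ : ∀ {m n} {φ ψ : Fin m → Fin n} → (∀ i → φ i ≡ ψ i) → ∀ f y → push φ f y ≈ push ψ f y
  push-≗ φ≗ψ f y = sumF-cong (λ i → ≡⇒≈ (≡.cong (λ z → ind (z ≟ y) (f i)) (φ≗ψ i)))

  push-id : ∀ {n} (f : Fin n → Carrier) y → push (λ i → i) f y ≈ f y
  push-id f y = sumF-ind-≟ y f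

module _ {c ℓ₁ ℓ₂} (O : TotalPreorder c ℓ₁ ℓ₂) where
  open TotalPreorder O

  argmin : ∀ {n} → Fin n → (f : Fin n → Carrier) → ∃ λ i → ∀ j → f i ≲ f j
  argmin {suc zero}    _ f = zero , λ { zero → refl }
  argmin {suc (suc n)} _ f with argmin zero (f ∘ suc)
  ... | i , fi≲ with total (f zero) (f (suc i))
  ... | inj₁ f0≲fi = zero  , λ { zero → refl ; (suc j) → trans f0≲fi (fi≲ j) }
  ... | inj₂ fi≲f0 = suc i , λ { zero → fi≲f0 ; (suc j) → fi≲ j }

boundℕ : ∀ {n} (f : Fin n → ℕ) → ∃ λ N → ∀ i → f i ≤ℕ N
boundℕ {zero}  f = 0 , λ ()
boundℕ {suc n} f with boundℕ (f ∘ suc)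
... | N , f≤N = f zero ⊔ N , λ { zero    → ℕ.m≤m⊔n (f zero) N
                             ; (suc i) → ℕ.≤-trans (f≤N i) (ℕ.m≤n⊔m (f zero) N) }

decSubset : ∀ {n} {Q : Fin n → Set} → (∀ i → Dec (Q i)) → Subset n
decSubset {zero}  d = []
decSubset {suc n} d with d zero
... | yes _ = inside  ∷ decSubset (d ∘ suc)
... | no  _ = outside ∷ decSubset (d ∘ suc)

∈-decSubset⁻ : ∀ {n} {Q : Fin n → Set} (d : ∀ i → Dec (Q i)) {i} → i ∈ decSubset d → Q i
∈-decSubset⁻ {suc n} d {zero} i∈ with d zero
∈-decSubset⁻ {suc n} d {zero} i∈        | yes q = q
∈-decSubset⁻ {suc n} d {zero} ()        | no  _
∈-decSubset⁻ {suc n} d {suc i} i∈ with d zero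
∈-decSubset⁻ {suc n} d {suc i} (there p) | yes _ = ∈-decSubset⁻ (d ∘ suc) p
∈-decSubset⁻ {suc n} d {suc i} (there p) | no  _ = ∈-decSubset⁻ (d ∘ suc) p

∈-decSubset⁺ : ∀ {n} {Q : Fin n → Set} (d : ∀ i → Dec (Q i)) {i} → Q i → i ∈ decSubset d
∈-decSubset⁺ {suc n} d {zero} q with d zero
... | yes _ = here
... | no ¬q = ⊥-elim (¬q q)
∈-decSubset⁺ {suc n} d {suc i} q with d zero
... | yes _ = there (∈-decSubset⁺ (d ∘ suc) q)
... | no  _ = there (∈-decSubset⁺ (d ∘ suc) q)

⊆∧∣q∣≤∣p∣⇒⊇ : ∀ {n} {p q : Subset n} → p ⊆ q → card q ≤ℕ card p → q ⊆ p
⊆∧∣q∣≤∣p∣⇒⊇ {p = p} {q} p⊆q ∣q∣≤∣p∣ {y} y∈q with y ∈? p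
... | yes y∈p = y∈p
... | no  y∉p = ⊥-elim (ℕ.<⇒≱ (p⊂q⇒∣p∣<∣q∣ {p = p} {q} (p⊆q , y , y∈q , y∉p)) ∣q∣≤∣p∣)

module WalkProperties (F : OrderedField) (M : FiniteMonoid) {k : ℕ} (A : Action M k)
                      (P : Fin (FiniteMonoid.size M) → OrderedField.Carrier F) where
  open OrderedField F
  open OrderedFieldProperties F
  open FiniteMonoid M
  open Action A
  open Walk F M A P

  ∈MxM? : ∀ x y → Dec (∃ λ u → ∃ λ v → ((u ∙ x) ∙ v) ≡ y)
  ∈MxM? x y = any? λ u → any? λ v → ((u ∙ x) ∙ v) ≟ y

  principalIdeal : Fin size → Subset size
  principalIdeal x = decSubset (∈MxM? x)

  principalIdeal-isIdeal : ∀ x → IsIdeal (principalIdeal x)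
  principalIdeal-isIdeal x = (x , ∈-decSubset⁺ (∈MxM? x) (e , e , x∈MxM)) , closed
    where
    x∈MxM : ((e ∙ x) ∙ e) ≡ x
    x∈MxM = ≡.trans (identityʳ (e ∙ x)) (identityˡ x)
    closed : ∀ w z → w ∈ principalIdeal x → ((z ∙ w) ∈ principalIdeal x) × ((w ∙ z) ∈ principalIdeal x)
    closed w z w∈ with ∈-decSubset⁻ (∈MxM? x) w∈
    ... | u , v , uxv≡w =
      ∈-decSubset⁺ (∈MxM? x) (z ∙ u , v , ≡.trans (≡.cong (_∙ v) (assoc z u x))
                                             (≡.trans (assoc z (u ∙ x) v) (≡.cong (z ∙_) uxv≡w))) ,
      ∈-decSubset⁺ (∈MxM? x) (u , v ∙ z , ≡.trans (≡.sym (assoc (u ∙ x) v z)) (≡.cong (_∙ z) uxv≡w))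

  principalIdeal-⊆ : ∀ {J} → IsIdeal J → ∀ {j} → j ∈ J → principalIdeal j ⊆ J
  principalIdeal-⊆ {J} (_ , closed) {j} j∈J w∈ with ∈-decSubset⁻ (∈MxM? j) w∈
  ... | u , v , ujv≡w = ≡.subst (_∈ J) ujv≡w (proj₂ (closed (u ∙ j) v (proj₁ (closed j u j∈J))))

  -- A principal ideal of least cardinality is minimal.
  minimalIdeal : ∃ IsMinimalIdeal
  minimalIdeal with argmin ℕ.≤-totalPreorder e (card ∘ principalIdeal)
  ... | x , least = principalIdeal x , principalIdeal-isIdeal x , minimal
    where
    minimal : ∀ J → IsIdeal J → J ⊆ principalIdeal x → principalIdeal x ⊆ J
    minimal J J-ideal J⊆ with proj₁ J-ideal
    ... | j , j∈J = principalIdeal-⊆ J-ideal j∈J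
                    ∘ ⊆∧∣q∣≤∣p∣⇒⊇ (principalIdeal-⊆ (principalIdeal-isIdeal x) (J⊆ j∈J)) (least j)

  IsConstant-∙ˡ : ∀ x {z} → IsConstant z → IsConstant (x ∙ z)
  IsConstant-∙ˡ x {z} z-const ω ω′ =
    ≡.trans (act-∙ x z ω) (≡.trans (≡.cong (act x) (z-const ω ω′)) (≡.sym (act-∙ x z ω′)))

  -- The minimal ideal lies inside the ideal of constant maps, and consists of generated elements.
  generated-constant : Adapted → ∃ IsConstant → ∃ λ g → Gen g × IsConstant g
  generated-constant adapted (z , z-const) with minimalIdeal
  ... | K , K-minimal@(((x , x∈K) , K-closed) , _) =
    x ∙ z , adapted K K-minimal (x ∙ z) (proj₂ (K-closed x z x∈K)) , IsConstant-∙ˡ x z-const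

  step-mixture : ∀ ν α → step ν α ≈ sumF (λ a → P a * push (act a) ν α)
  step-mixture ν α = begin
    sumF (λ β → T α β * ν β)
      ≈⟨ sumF-cong (λ β → sym (sumF-*ʳ (ν β) (λ a → ind (act a β ≟ α) (P a)))) ⟩
    sumF (λ β → sumF λ a → ind (act a β ≟ α) (P a) * ν β)
      ≈⟨ sumF-swap (λ β a → ind (act a β ≟ α) (P a) * ν β) ⟩
    sumF (λ a → sumF λ β → ind (act a β ≟ α) (P a) * ν β)
      ≈⟨ sumF-cong (λ a → trans (sumF-cong (λ β → ind-*ʳ (act a β ≟ α) (P a) (ν β)))
                                (sumF-ind-*ˡ (λ β → act a β ≟ α) (P a) ν)) ⟩
    sumF (λ a → P a * push (act a) ν α) ∎

  -- conv f h x unfolds to Σ_a push (a ∙_) (λ m → f a * h m) x.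
  sumF-conv-* : ∀ f h (g : Fin size → Carrier) →
                sumF (λ x → conv f h x * g x) ≈ sumF (λ a → sumF (λ m → (f a * h m) * g (a ∙ m)))
  sumF-conv-* f h g = begin
    sumF (λ x → conv f h x * g x)
      ≈⟨ sumF-cong (λ x → sym (sumF-*ʳ (g x) (λ a → push (a ∙_) (λ m → f a * h m) x))) ⟩
    sumF (λ x → sumF λ a → push (a ∙_) (λ m → f a * h m) x * g x)
      ≈⟨ sumF-swap (λ x a → push (a ∙_) (λ m → f a * h m) x * g x) ⟩
    sumF (λ a → sumF λ x → push (a ∙_) (λ m → f a * h m) x * g x)
      ≈⟨ sumF-cong (λ a → sumF-push-* (a ∙_) (λ m → f a * h m) g) ⟩
    sumF (λ a → sumF (λ m → (f a * h m) * g (a ∙ m))) ∎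

  stepN-mixture : ∀ n ν α → stepN n ν α ≈ sumF (λ m → convPow n m * push (act m) ν α)
  stepN-mixture zero ν α = sym (begin
    sumF (λ m → ind (m ≟ e) 1# * push (act m) ν α)
      ≈⟨ sumF-cong (λ m → ind-*ʳ (m ≟ e) 1# (push (act m) ν α)) ⟩
    sumF (λ m → ind (m ≟ e) (1# * push (act m) ν α))
      ≈⟨ sumF-ind-≟ e (λ m → 1# * push (act m) ν α) ⟩
    1# * push (act e) ν α  ≈⟨ *-identityˡ (push (act e) ν α) ⟩
    push (act e) ν α       ≈⟨ push-≗ act-e ν α ⟩
    push (λ β → β) ν α     ≈⟨ push-id ν α ⟩
    ν α                    ∎)
  stepN-mixture (suc n) ν α = begin
    step (stepN n ν) α
      ≈⟨ sumF-cong (λ β → *-congˡ (stepN-mixture n ν β)) ⟩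
    step (λ β → sumF (λ m → c m * push (act m) ν β)) α
      ≈⟨ step-mixture _ α ⟩
    sumF (λ a → P a * push (act a) (λ β → sumF (λ m → c m * push (act m) ν β)) α)
      ≈⟨ sumF-cong (λ a → *-congˡ (push-mixture (act a) c (λ m → push (act m) ν) α)) ⟩
    sumF (λ a → P a * sumF (λ m → c m * push (act a) (push (act m) ν) α))
      ≈⟨ sumF-cong (λ a → trans (sym (sumF-*ˡ (P a) (λ m → c m * push (act a) (push (act m) ν) α)))
                                (sumF-cong (compose a))) ⟩
    sumF (λ a → sumF (λ m → (P a * c m) * push (act (a ∙ m)) ν α))
      ≈⟨ sym (sumF-conv-* P c (λ x → push (act x) ν α)) ⟩
    sumF (λ x → conv P c x * push (act x) ν α) ∎
    where
    c = convPow n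
    compose : ∀ a m → (P a * (c m * push (act a) (push (act m) ν) α)) ≈ ((P a * c m) * push (act (a ∙ m)) ν α)
    compose a m = trans (sym (*-assoc (P a) (c m) _))
                    (*-congˡ (trans (push-∘ (act a) (act m) ν α) (sym (push-≗ (act-∙ a m) ν α))))

  stepL-mixture : ∀ μ y → stepL μ y ≈ sumF (λ a → P a * push (a ∙_) μ y)
  stepL-mixture μ y =
    trans (sumF-swap (λ x a → ind ((a ∙ x) ≟ y) (P a * μ x)))
          (sumF-cong (λ a → sumF-ind-*ˡ (λ x → (a ∙ x) ≟ y) (P a) μ))

  step-push-orbit : ∀ ω μ α → step (push (λ x → act x ω) μ) α ≈ push (λ x → act x ω) (stepL μ) α
  step-push-orbit ω μ α = begin
    step (push orbit μ) α
      ≈⟨ step-mixture (push orbit μ) α ⟩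
    sumF (λ a → P a * push (act a) (push orbit μ) α)
      ≈⟨ sumF-cong (λ a → *-congˡ (reorder a)) ⟩
    sumF (λ a → P a * push orbit (push (a ∙_) μ) α)
      ≈⟨ sym (push-mixture orbit P (λ a → push (a ∙_) μ) α) ⟩
    push orbit (λ y → sumF (λ a → P a * push (a ∙_) μ y)) α
      ≈⟨ sym (push-cong orbit (stepL-mixture μ) α) ⟩
    push orbit (stepL μ) α ∎
    where
    orbit : Fin size → Fin k
    orbit x = act x ω
    reorder : ∀ a → push (act a) (push orbit μ) α ≈ push orbit (push (a ∙_) μ) α
    reorder a = begin
      push (act a) (push orbit μ) α    ≈⟨ push-∘ (act a) orbit μ α ⟩
      push (act a ∘ orbit) μ α         ≈⟨ push-≗ (λ x → ≡.sym (act-∙ a x ω)) μ α ⟩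
      push (orbit ∘ (a ∙_)) μ α        ≈⟨ sym (push-∘ orbit (a ∙_) μ α) ⟩
      push orbit (push (a ∙_) μ) α     ∎

  stepL-stationary : ∀ {L μ} → IsLeftIdeal L → StationaryOn L μ → ∀ y → stepL μ y ≈ μ y
  stepL-stationary {L} {μ} (_ , L-closed) (_ , μ-off-L , μ-inv) y with y ∈? L
  ... | yes y∈L = μ-inv y y∈L
  ... | no  y∉L = trans (sumF-zero (λ x → sumF-zero (λ a → no-mass x a))) (sym (μ-off-L y y∉L))
    where
    no-mass : ∀ x a → ind ((a ∙ x) ≟ y) (P a * μ x) ≈ 0#
    no-mass x a with x ∈? L
    ... | yes x∈L = ≡⇒≈ (ind-no ((a ∙ x) ≟ y) (λ ax≡y → y∉L (≡.subst (_∈ L) ax≡y (L-closed x a x∈L))) (P a * μ x))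
    ... | no  x∉L = trans (ind-cong ((a ∙ x) ≟ y) (trans (*-congˡ (μ-off-L x x∉L)) (zeroʳ (P a)))) (ind-0 ((a ∙ x) ≟ y))

  push-orbit-stationary : ∀ {L μ} → IsLeftIdeal L → StationaryOn L μ →
                          ∀ ω → Stationary (push (λ x → act x ω) μ)
  push-orbit-stationary L-left μ-stat ω =
    push-probability (λ x → act x ω) (proj₁ μ-stat) ,
    λ α → trans (step-push-orbit ω _ α) (push-cong (λ x → act x ω) (stepL-stationary L-left μ-stat) α)

  -- A record rather than a synonym for 0# < Tpow n α β, so that n, α, β can be inferred.
  record Reaches (n : ℕ) (β α : Fin k) : Set where
    constructor reaches
    field 0<Tpow : 0# < Tpow n α β
  open Reaches

  reaches-irr : (irr : Irreducible) → ∀ α β → Reaches (proj₁ (irr α β)) β α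
  reaches-irr irr α β = reaches (proj₂ (irr α β))

  module _ (P≥0 : ∀ a → 0# ≤ P a) where

    T-nonneg : ∀ α β → 0# ≤ T α β
    T-nonneg α β = sumF-nonneg (λ m → ind-nonneg (act m β ≟ α) (P≥0 m))

    Tpow-nonneg : ∀ n α β → 0# ≤ Tpow n α β
    Tpow-nonneg zero    α β = ind-nonneg (α ≟ β) 0≤1
    Tpow-nonneg (suc n) α β = sumF-nonneg (λ γ → *-nonneg (T-nonneg α γ) (Tpow-nonneg n γ β))

    convPow-nonneg : ∀ n m → 0# ≤ convPow n m
    convPow-nonneg zero    m = ind-nonneg (m ≟ e) 0≤1
    convPow-nonneg (suc n) m = sumF-nonneg λ x → sumF-nonneg λ y →
                                 ind-nonneg ((x ∙ y) ≟ m) (*-nonneg (P≥0 x) (convPow-nonneg n y))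

    T-pos : ∀ {a} → 0# < P a → ∀ γ → 0# < T (act a γ) γ
    T-pos {a} 0<Pa γ = sumF-pos (λ m → ind-nonneg (act m γ ≟ act a γ) (P≥0 m)) a
                         (≡.subst (0# <_) (≡.sym (ind-yes (act a γ ≟ act a γ) ≡.refl (P a))) 0<Pa)

    reaches-refl : ∀ α → Reaches 0 α α
    reaches-refl α = reaches (≡.subst (0# <_) (≡.sym (ind-yes (α ≟ α) ≡.refl 1#)) 0<1)

    reaches-0⁻ : ∀ {α β} → Reaches 0 β α → α ≡ β
    reaches-0⁻ {α} {β} (reaches 0<δ) with α ≟ β
    ... | yes α≡β = α≡β
    ... | no  _   = ⊥-elim (proj₂ 0<δ refl)

    reaches-suc : ∀ {n α β γ} → Reaches n β γ → 0# < T α γ → Reaches (suc n) β α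
    reaches-suc {n} {α} {β} {γ} (reaches 0<Tpowγβ) 0<Tαγ = reaches
      (sumF-pos (λ γ′ → *-nonneg (T-nonneg α γ′) (Tpow-nonneg n γ′ β)) γ (*-pos 0<Tαγ 0<Tpowγβ))

    reaches-suc⁻ : ∀ {n α β} → Reaches (suc n) β α → ∃ λ γ → Reaches n β γ × 0# < T α γ
    reaches-suc⁻ {n} {α} {β} (reaches 0<Tpow)
      with sumF-pos⁻ (λ γ → *-nonneg (T-nonneg α γ) (Tpow-nonneg n γ β)) 0<Tpow
    ... | γ , 0<TT = γ , reaches (*-pos⁻ʳ (Tpow-nonneg n γ β) 0<TT) , *-pos⁻ˡ (T-nonneg α γ) 0<TT

    reaches-trans : ∀ {m n α β γ} → Reaches n β γ → Reaches m γ α → Reaches (m +ℕ n) β α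
    reaches-trans {zero}  β⇝γ γ⇝α = ≡.subst (Reaches _ _) (≡.sym (reaches-0⁻ γ⇝α)) β⇝γ
    reaches-trans {suc m} β⇝γ γ⇝α with reaches-suc⁻ γ⇝α
    ... | δ , γ⇝δ , 0<Tαδ = reaches-suc (reaches-trans β⇝γ γ⇝δ) 0<Tαδ

    Gen-reaches : ∀ {g} → Gen g → ∃ λ n → ∀ β → Reaches n β (act g β)
    Gen-reaches gen-e = 0 , λ β → ≡.subst (Reaches 0 β) (≡.sym (act-e β)) (reaches-refl β)
    Gen-reaches (gen-∙ {a} {b} 0<Pa b-gen) with Gen-reaches b-gen
    ... | n , reach-b = suc n , λ β →
      ≡.subst (Reaches (suc n) β) (≡.sym (act-∙ a b β)) (reaches-suc (reach-b β) (T-pos 0<Pa (act b β)))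

    reaches-somewhere : ∀ {a} → 0# < P a → ∀ j β → ∃ (Reaches j β)
    reaches-somewhere 0<Pa zero    β = β , reaches-refl β
    reaches-somewhere {a} 0<Pa (suc j) β with reaches-somewhere 0<Pa j β
    ... | γ , β⇝γ = act a γ , reaches-suc β⇝γ (T-pos 0<Pa γ)

    ergodic : IsProbability P → Adapted → Irreducible → ∃ IsConstant → Ergodic
    ergodic P-prob adapted irr ∃const
      with generated-constant adapted ∃const | probability-support P-prob
    ... | g , g-gen , g-const | a , 0<Pa with Gen-reaches g-gen
    ... | n , ⇝g = N +ℕ n , λ α β → 0<Tpow (reaches-everywhere α β)
      where
      hit : Fin k → Fin k → ℕ
      hit α γ = proj₁ (irr α γ)
      N = proj₁ (boundℕ λ α → proj₁ (boundℕ (hit α)))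
      hit≤N : ∀ α γ → hit α γ ≤ℕ N
      hit≤N α γ = ℕ.≤-trans (proj₂ (boundℕ (hit α)) γ) (proj₂ (boundℕ λ α → proj₁ (boundℕ (hit α))) α)
      reaches-everywhere : ∀ α β → Reaches (N +ℕ n) β α
      reaches-everywhere α β with reaches-somewhere 0<Pa (N ∸ hit α (act g β)) β
      ... | γ , β⇝γ = ≡.subst (λ l → Reaches l β α) length
                          (reaches-trans (reaches-trans β⇝γ γ⇝c) (reaches-irr irr α c))
        where
        c = act g β
        m = hit α c
        γ⇝c : Reaches n γ c
        γ⇝c = ≡.subst (Reaches n γ) (g-const γ β) (⇝g γ)
        length : m +ℕ (n +ℕ (N ∸ m)) ≡ N +ℕ n
        length = ≡.trans (≡.cong (m +ℕ_) (ℕ.+-comm n (N ∸ m)))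
                   (≡.trans (≡.sym (ℕ.+-assoc m (N ∸ m) n)) (≡.cong (_+ℕ n) (ℕ.m+[n∸m]≡n (hit≤N α c))))

    stepN-stationary : ∀ {π} → Stationary π → ∀ n α → stepN n π α ≈ π α
    stepN-stationary π-stat zero    α = refl
    stepN-stationary π-stat (suc n) α =
      trans (sumF-cong (λ β → *-congˡ (stepN-stationary π-stat n β))) (proj₂ π-stat α)

    measure-stepN : ∀ n ν S → measure (stepN n ν) S ≈ sumF (λ m → convPow n m * measure (push (act m) ν) S)
    measure-stepN n ν S = trans (sumF-cong (λ α → ind-cong (α ∈? S) (stepN-mixture n ν α)))
                                (sumF-ind-mixture (_∈? S) (convPow n) (λ m → push (act m) ν))

    measure-bounds : ∀ {ν} → IsProbability ν → ∀ S → (0# ≤ measure ν S) × (measure ν S ≤ 1#)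
    measure-bounds (0≤ν , Σν≈1) S =
      sumF-nonneg (λ α → ind-nonneg (α ∈? S) (0≤ν α)) ,
      ≤-respʳ-≈ Σν≈1 (sumF-mono (λ α → ind-≤ (α ∈? S) (0≤ν α)))

    -- A constant map sends every probability to the same point mass.
    term-within : ∀ {ν π} → IsProbability ν → IsProbability π → ∀ n S m →
                  (convPow n m * (measure (push (act m) ν) S - measure (push (act m) π) S))
                    within± ind (¬? (isConstant? m)) (convPow n m)
    term-within {ν} {π} ν-prob π-prob n S m with isConstant? m
    ... | yes m-const = ≈0-within±0 (trans (*-congˡ (trans (+-congʳ same-measure) (-‿inverseʳ _))) (zeroʳ _))
      where
      b = proj₁ (probability-support ν-prob)
      same-push : ∀ α → push (act m) ν α ≈ push (act m) π α
      same-push α = trans (push-constant (act m) m-const (proj₂ ν-prob) b α)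
                          (sym (push-constant (act m) m-const (proj₂ π-prob) b α))
      same-measure : measure (push (act m) ν) S ≈ measure (push (act m) π) S
      same-measure = sumF-cong (λ α → ind-cong (α ∈? S) (same-push α))
    ... | no _ with measure-bounds (push-probability (act m) ν-prob) S | measure-bounds (push-probability (act m) π-prob) S
    ...   | 0≤νₘ , νₘ≤1 | 0≤πₘ , πₘ≤1 = *-within± (convPow-nonneg n m) (x-y-within±1 0≤νₘ νₘ≤1 0≤πₘ πₘ≤1)

    tv-bound : ∀ {π ν} → Stationary π → IsProbability ν → ∀ n → tv (stepN n ν) π ≤ massOutsideI n
    tv-bound {π} {ν} π-stat ν-prob n =
      foldr-max-lub _ (allSubsets k)
        (sumF-nonneg (λ m → ind-nonneg (¬? (isConstant? m)) (convPow-nonneg n m)))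
        (λ S → within±⇒∣∣≤ (within±-respˡ-≈ (difference S)
                                             (sumF-within± (term-within ν-prob (proj₁ π-stat) n S))))
      where
      c = convPow n
      difference : ∀ S → (measure (stepN n ν) S - measure π S)
                         ≈ sumF (λ m → c m * (measure (push (act m) ν) S - measure (push (act m) π) S))
      difference S = begin
        measure (stepN n ν) S - measure π S
          ≈⟨ +-congˡ (-‿cong (sumF-cong (λ α → ind-cong (α ∈? S) (sym (stepN-stationary π-stat n α))))) ⟩
        measure (stepN n ν) S - measure (stepN n π) S
          ≈⟨ +-cong (measure-stepN n ν S) (-‿cong (measure-stepN n π S)) ⟩
        sumF (λ m → c m * νₘ m) - sumF (λ m → c m * πₘ m)
          ≈⟨ sym (sumF-sub (λ m → c m * νₘ m) (λ m → c m * πₘ m)) ⟩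
        sumF (λ m → c m * νₘ m - c m * πₘ m)
          ≈⟨ sumF-cong (λ m → sym (x[y-z]≈xy-xz (c m) (νₘ m) (πₘ m))) ⟩
        sumF (λ m → c m * (νₘ m - πₘ m)) ∎
        where
        νₘ πₘ : Fin size → Carrier
        νₘ m = measure (push (act m) ν) S
        πₘ m = measure (push (act m) π) S

    invariant-zero : (g : Fin k → Carrier) → (∀ β → 0# ≤ g β) → (∀ α → step g α ≈ g α) →
                     ∀ {n α β} → Reaches n β α → g α ≈ 0# → g β ≈ 0#
    invariant-zero g g≥0 g-inv {zero}      β⇝α gα≈0 = ≡.subst (λ z → g z ≈ 0#) (reaches-0⁻ β⇝α) gα≈0
    invariant-zero g g≥0 g-inv {suc n} {α} β⇝α gα≈0 with reaches-suc⁻ β⇝α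
    ... | γ , β⇝γ , 0<Tαγ = invariant-zero g g≥0 g-inv β⇝γ
            (x≉0∧xy≈0⇒y≈0 (proj₂ 0<Tαγ ∘ sym)
              (sumF≈0⇒f≈0 (λ γ′ → *-nonneg (T-nonneg α γ′) (g≥0 γ′)) (trans (g-inv α) gα≈0) γ))

    stationary-pos : Irreducible → ∀ {ρ} → Stationary ρ → ∀ α → ¬ (ρ α ≈ 0#)
    stationary-pos irr {ρ} ((ρ≥0 , Σρ≈1) , ρ-inv) α ρα≈0 =
      0≉1 (trans (sym (sumF-zero (λ β → invariant-zero ρ ρ≥0 ρ-inv (reaches-irr irr α β) ρα≈0))) Σρ≈1)

    -- With t the least ratio π/ρ, π - t ρ is nonnegative, invariant and vanishes somewhere, hence
    -- everywhere; total mass then forces t = 1.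
    stationary-unique : Irreducible → ∀ {π ρ} → Stationary π → Stationary ρ → ∀ β → π β ≈ ρ β
    stationary-unique irr {π} {ρ} π-stat@((_ , Σπ≈1) , π-inv) ρ-stat@((ρ≥0 , Σρ≈1) , ρ-inv) β =
      trans (π≈tρ β) (trans (*-congʳ t≈1) (*-identityˡ (ρ β)))
      where
      ρ⁻¹ : Fin k → Carrier
      ρ⁻¹ γ = proj₁ (inverse (ρ γ) (stationary-pos irr ρ-stat γ))
      ratio : Fin k → Carrier
      ratio γ = π γ * ρ⁻¹ γ
      ratio*ρ : ∀ γ → (ratio γ * ρ γ) ≈ π γ
      ratio*ρ γ = trans (*-assoc (π γ) (ρ⁻¹ γ) (ρ γ))
        (trans (*-congˡ (trans (*-comm (ρ⁻¹ γ) (ρ γ)) (proj₂ (inverse (ρ γ) (stationary-pos irr ρ-stat γ)))))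
               (*-identityʳ (π γ)))
      least = argmin (TotalOrder.totalPreorder totalOrder) β ratio
      t = ratio (proj₁ least)
      g : Fin k → Carrier
      g γ = π γ - t * ρ γ
      g≥0 : ∀ γ → 0# ≤ g γ
      g≥0 γ = x≤y⇒0≤y-x (≤-respʳ-≈ (ratio*ρ γ) (*-monoʳ-nonneg (ρ γ) (ρ≥0 γ) (proj₂ least γ)))
      g-inv : ∀ α → step g α ≈ g α
      g-inv α = begin
        sumF (λ γ → T α γ * (π γ - t * ρ γ))
          ≈⟨ sumF-cong (λ γ → trans (x[y-z]≈xy-xz (T α γ) (π γ) (t * ρ γ)) (+-congˡ (-‿cong (swap γ)))) ⟩
        sumF (λ γ → T α γ * π γ - t * (T α γ * ρ γ))
          ≈⟨ sumF-sub (λ γ → T α γ * π γ) (λ γ → t * (T α γ * ρ γ)) ⟩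
        step π α - sumF (λ γ → t * (T α γ * ρ γ))
          ≈⟨ +-cong (π-inv α) (-‿cong (trans (sumF-*ˡ t (λ γ → T α γ * ρ γ)) (*-congˡ (ρ-inv α)))) ⟩
        g α ∎
        where
        swap : ∀ γ → (T α γ * (t * ρ γ)) ≈ (t * (T α γ * ρ γ))
        swap γ = trans (sym (*-assoc (T α γ) t (ρ γ)))
                   (trans (*-congʳ (*-comm (T α γ) t)) (*-assoc t (T α γ) (ρ γ)))
      π≈tρ : ∀ γ → π γ ≈ (t * ρ γ)
      π≈tρ γ = x∙y⁻¹≈ε⇒x≈y (π γ) (t * ρ γ)
        (invariant-zero g g≥0 g-inv (reaches-irr irr (proj₁ least) γ)
          (trans (+-congˡ (-‿cong (ratio*ρ (proj₁ least)))) (-‿inverseʳ (π (proj₁ least)))))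
      t≈1 : t ≈ 1#
      t≈1 = begin
        t                     ≈⟨ sym (*-identityʳ t) ⟩
        t * 1#                ≈⟨ *-congˡ (sym Σρ≈1) ⟩
        t * sumF ρ            ≈⟨ sym (sumF-*ˡ t ρ) ⟩
        sumF (λ γ → t * ρ γ)  ≈⟨ sym (sumF-cong π≈tρ) ⟩
        sumF π                ≈⟨ Σπ≈1 ⟩
        1#                    ∎

    orbit-formula : Irreducible → ∀ {L μ π} → IsMinimalLeftIdeal L → StationaryOn L μ → Stationary π →
                    ∀ ω → π ω ≈ sumF (λ x → ind ((x ∈? L) ×-dec (act x ω ≟ ω)) (μ x))
    orbit-formula irr {L} {μ} L-minimal μ-stat π-stat ω =
      trans (stationary-unique irr π-stat (push-orbit-stationary (proj₁ L-minimal) μ-stat ω) ω)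
            (sumF-cong restrict)
      where
      restrict : ∀ x → ind (act x ω ≟ ω) (μ x) ≈ ind ((x ∈? L) ×-dec (act x ω ≟ ω)) (μ x)
      restrict x with x ∈? L
      ... | yes _   = ≡⇒≈ (≡.sym (ind-× (yes _) (act x ω ≟ ω) (μ x)))
      ... | no  x∉L = trans (ind-cong (act x ω ≟ ω) (proj₁ (proj₂ μ-stat) x x∉L)) (ind-0 (act x ω ≟ ω))

corollary3p5 : (F : OrderedField) (M : FiniteMonoid) {k : ℕ} (A : Action M k)
    (P : Fin (FiniteMonoid.size M) → OrderedField.Carrier F) →
    let open OrderedField F
        open FiniteMonoid M
        open Action A
        open Walk F M A P
    in IsProbability P → Adapted → Irreducible → ∃ IsConstant →
       Ergodic
       × (∀ (L : Subset size) (μ : Fin size → Carrier) (π : Fin k → Carrier) →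
            IsMinimalLeftIdeal L → StationaryOn L μ → Stationary π →
            ∀ ω → π ω ≈ sumF (λ x → ind ((x ∈? L) ×-dec (act x ω ≟ ω)) (μ x)))
       × (∀ (π ν : Fin k → Carrier) (n : ℕ) → Stationary π → IsProbability ν →
            tv (stepN n ν) π ≤ massOutsideI n)
corollary3p5 F M A P P-prob adapted irr ∃const =
  ergodic P≥0 P-prob adapted irr ∃const ,
  (λ L μ π → orbit-formula P≥0 irr) ,
  (λ π ν n π-stat ν-prob → tv-bound P≥0 π-stat ν-prob n)
  where
  open WalkProperties F M A P
  P≥0 = proj₁ P-prob
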